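{- Let $n$ and $t$ be integers with $3\leq t\leq n$, and let $G_n^t$ be the graph obtained as follows: partition the vertex set of the complete graph $K_n$ into $t$ classes $V_1,\dots,V_t$ with $\bigl||V_j|-|V_r|\bigr|\leq 1$ for all $j\neq r$; for each $j$ choose a vertex $v_j^*\in V_j$ and delete all edges joining $v_j^*$ to the other vertices of $V_j$. Then $mc(G_n^t)=\binom{n}{2}-2n+2t$.
   Context: All graphs are finite, simple and undirected. For a connected graph $G$, an edge-coloring of $G$ (adjacent edges may receive the same color) is a monochromatic connection coloring (MC-coloring) if any two vertices of $G$ are joined by a path all of whose edges have the same color. The monochromatic connection number $mc(G)$ is the maximum number of colors used in an MC-coloring of $G$. -}

module Defs where

open import Data.Nat using (ℕ; suc; _≤_)
open import Data.Fin using (Fin; _≟_)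
open import Data.List using (List; []; _∷_; length; filter; allFin)
open import Data.List.Relation.Unary.Unique.Propositional using (Unique)
open import Data.Product using (Σ; ∃; ∃-syntax; _×_; _,_; proj₁)
open import Relation.Binary.PropositionalEquality using (_≡_; _≢_; refl; sym)
open import Relation.Nullary using (¬_)
open import Data.Sum using (_⊎_; inj₁; inj₂)

record Graph (n : ℕ) : Set₁ where
  field
    Adj       : Fin n → Fin n → Set
    irrefl    : ∀ {u} → ¬ Adj u u
    symmetric : ∀ {u v} → Adj u v → Adj v u
open Graph public

data MonoWalk {n k : ℕ} (G : Graph n) (col : Fin n → Fin n → Fin k) (c : Fin k)
     : Fin n → Fin n → List (Fin n) → Set where
  here : ∀ u → MonoWalk G col c u u (u ∷ [])
  step : ∀ {u v w vs} → Adj G u v → col u v ≡ c →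
         MonoWalk G col c v w vs → MonoWalk G col c u w (u ∷ vs)

MonoPath : {n k : ℕ} → Graph n → (Fin n → Fin n → Fin k) → Fin n → Fin n → Set
MonoPath G col u v = ∃[ c ] ∃[ vs ] (MonoWalk G col c u v vs × Unique vs)

-- An edge-colouring using exactly k colours: a symmetric map on pairs (only its
-- values on edges matter) such that every colour in Fin k appears on some edge.
record EdgeColoring {n : ℕ} (G : Graph n) (k : ℕ) : Set where
  field
    col  : Fin n → Fin n → Fin k
    col-sym : ∀ u v → col u v ≡ col v u
    onto : ∀ (a : Fin k) → ∃[ u ] ∃[ v ] (Adj G u v × col u v ≡ a)
open EdgeColoring public

IsMC : {n k : ℕ} (G : Graph n) → EdgeColoring G k → Set
IsMC G χ = ∀ u v → u ≢ v → MonoPath G (col χ) u v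

MCNumber : {n : ℕ} → Graph n → ℕ → Set
MCNumber G m =
  (Σ (EdgeColoring G m) (IsMC G)) ×
  (∀ k (χ : EdgeColoring G k) → IsMC G χ → k ≤ m)

classSize : {n t : ℕ} → (Fin n → Fin t) → Fin t → ℕ
classSize {n} cls j = length (filter (λ v → cls v ≟ j) (allFin n))

Balanced : {n t : ℕ} → (Fin n → Fin t) → Set
Balanced {t = t} cls = ∀ (j r : Fin t) → classSize cls j ≤ suc (classSize cls r)

-- G_n^t: K_n minus all edges joining v_j* = star j to the other vertices of V_j.
Gnt-Adj : {n t : ℕ} → (Fin n → Fin t) → (Fin t → Fin n) → Fin n → Fin n → Set
Gnt-Adj cls star u v =
  u ≢ v × ¬ (cls u ≡ cls v × (u ≡ star (cls u) ⊎ v ≡ star (cls v)))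

Gnt : {n t : ℕ} → (Fin n → Fin t) → (Fin t → Fin n) → Graph n
Gnt cls star = record
  { Adj = Gnt-Adj cls star
  ; irrefl = λ p → proj₁ p refl
  ; symmetric = λ { (u≢v , h) → (λ e → u≢v (sym e))
                              , λ { (e , inj₁ x) → h (sym e , inj₂ x)
                                  ; (e , inj₂ y) → h (sym e , inj₁ y) } }
  }

-- For a colour a let G_a be the spanning subgraph of the edges coloured a;
-- together the graphs G_a have at least k·n − |E| components. Each non-star u is joined to the
-- star of its class by a path of some colour a_u; call u routed in a_u. In G_{a_u} the star
-- shares the component of u and is not routed, and as colour a occurs on some edge, G_a also
-- has two distinct unrouted vertices w_a, z_a in one component. So every component of G_a
-- contains an unrouted vertex other than w_a, and G_a has at most n − 1 − #{u : a_u = a}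
-- components; summing over a gives k + (n − t) ≤ |E| = C(n,2) − (n − t).
--
-- Give each class j a hub, the star of another class, such that no two classes
-- use each other's stars (possible as t ≥ 3). All edges from the hub of class j into class j
-- get one colour, every other edge a colour of its own. Two non-adjacent vertices lie in one
-- class and are joined through its hub, and the number of colours is |E| − n + t.
module Submission where

open import Defs
open import Data.Nat using (ℕ; zero; suc; z≤n; s≤s; _≤_; _+_; _*_; _∸_)
open import Data.Nat.Properties
  using ( ≤-refl; ≤-trans; ≮⇒≥; +-suc; +-assoc; +-comm; +-mono-≤; +-monoʳ-≤; +-monoˡ-≤; *-monoʳ-≤
        ; +-identityʳ; +-cancelˡ-≤; m+n≤o⇒m≤o∸n; m≤n+o⇒m∸n≤o; module ≤-Reasoning)
open import Data.Nat.Combinatorics using (_C_; nC1≡n; nCk+nC[k+1]≡[n+1]C[k+1])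
open import Data.Nat.Tactic.RingSolver using (solve-∀)
open import Data.Fin using (Fin; zero; suc; _<_; _<?_; _≟_; inject≤; fromℕ<)
open import Data.Fin.Properties
  using (suc-injective; injective⇒≤; inject≤-injective; any?; ≤∧≢⇒<; <⇒≢; <-asym; <-cmp)
open import Data.List using (List; []; _∷_; length; filter; map; _++_; lookup; allFin; cartesianProduct)
open import Data.List.Properties using (length-map; length-++; length-tabulate)
open import Data.List.Membership.Propositional using (_∈_)
open import Data.List.Membership.Propositional.Properties
  using ( ∈-lookup; ∈-map⁺; ∈-map⁻; ∈-++⁺ˡ; ∈-++⁺ʳ; ∈-++⁻; ∈-filter⁺; ∈-filter⁻; ∈-allFin
        ; ∈-cartesianProduct⁺)
open import Data.List.Relation.Unary.Any as Any using (here; there; index)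
open import Data.List.Relation.Unary.Any.Properties using (lookup-index)
open import Data.List.Relation.Unary.All as All using ([]; _∷_)
open import Data.List.Relation.Unary.AllPairs using ([]; _∷_)
open import Data.List.Relation.Unary.Unique.Propositional using (Unique)
import Data.List.Relation.Unary.Unique.Propositional.Properties as Unique
open import Data.Product using (Σ; ∃; _×_; _,_; proj₁; proj₂)
import Data.Product.Properties as Product
open import Data.Sum using (_⊎_; inj₁; inj₂; [_,_])
open import Data.Sum.Properties as Sum using (inj₁-injective; inj₂-injective)
open import Data.Empty using (⊥; ⊥-elim)
open import Function using (_∘_; id; case_of_)
open import Relation.Nullary using (¬_; Dec; yes; no; ¬?; _×-dec_; _⊎-dec_)
open import Relation.Unary using (Decidable)
open import Relation.Binary using (DecidableEquality; tri<; tri≈; tri>)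
open import Relation.Binary.PropositionalEquality
  using (_≡_; _≢_; refl; sym; trans; cong; cong₂; subst; subst₂; module ≡-Reasoning)

private
  variable
    A B D : Set
    n : ℕ

InjectiveOn : (A → B) → List A → Set
InjectiveOn f xs = ∀ {x y} → x ∈ xs → y ∈ xs → f x ≡ f y → x ≡ y

lookup-injective : {xs : List A} → Unique xs → ∀ i j → lookup xs i ≡ lookup xs j → i ≡ j
lookup-injective (_ ∷ _)      zero    zero    _  = refl
lookup-injective (x∉xs ∷ _)   zero    (suc j) eq = ⊥-elim (All.lookup x∉xs (∈-lookup j) eq)
lookup-injective (x∉xs ∷ _)   (suc i) zero    eq = ⊥-elim (All.lookup x∉xs (∈-lookup i) (sym eq))
lookup-injective (_ ∷ uniq)   (suc i) (suc j) eq = cong suc (lookup-injective uniq i j eq)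

-- Positions of xs are sent injectively to positions of ys, so Fin-counting applies.
injectiveOn⇒length≤ : (f : A → B) {xs : List A} {ys : List B} → Unique xs →
  (∀ {x} → x ∈ xs → f x ∈ ys) → InjectiveOn f xs → length xs ≤ length ys
injectiveOn⇒length≤ f {xs} {ys} uniq maps inj = injective⇒≤ position-injective
  where
  position : Fin (length xs) → Fin (length ys)
  position i = index (maps (∈-lookup i))
  position-injective : ∀ {i j} → position i ≡ position j → i ≡ j
  position-injective {i} {j} eq = lookup-injective uniq i j (inj (∈-lookup i) (∈-lookup j) (begin
    f (lookup xs i)            ≡⟨ lookup-index (maps (∈-lookup i)) ⟩
    lookup ys (position i)     ≡⟨ cong (lookup ys) eq ⟩
    lookup ys (position j)     ≡⟨ lookup-index (maps (∈-lookup j)) ⟨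
    f (lookup xs j)            ∎))
    where open ≡-Reasoning

length-filter-∁ : {P : A → Set} (P? : Decidable P) (xs : List A) →
  length (filter P? xs) + length (filter (λ x → ¬? (P? x)) xs) ≡ length xs
length-filter-∁ P? [] = refl
length-filter-∁ P? (x ∷ xs) with P? x
... | yes _ = cong suc (length-filter-∁ P? xs)
... | no  _ = trans (+-suc _ _) (cong suc (length-filter-∁ P? xs))

infixr 5 _⊕_

_⊕_ : List A → List B → List (A ⊎ B)
xs ⊕ ys = map inj₁ xs ++ map inj₂ ys

length-⊕ : (xs : List A) (ys : List B) → length (xs ⊕ ys) ≡ length xs + length ys
length-⊕ xs ys = trans (length-++ (map inj₁ xs)) (cong₂ _+_ (length-map inj₁ xs) (length-map inj₂ ys))

∈-⊕⁺ˡ : {xs : List A} (ys : List B) {x : A} → x ∈ xs → inj₁ x ∈ xs ⊕ ys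
∈-⊕⁺ˡ ys x∈xs = ∈-++⁺ˡ (∈-map⁺ inj₁ x∈xs)

∈-⊕⁺ʳ : (xs : List A) {ys : List B} {y : B} → y ∈ ys → inj₂ y ∈ xs ⊕ ys
∈-⊕⁺ʳ xs y∈ys = ∈-++⁺ʳ (map inj₁ xs) (∈-map⁺ inj₂ y∈ys)

∈-⊕⁻ : (xs : List A) (ys : List B) {z : A ⊎ B} → z ∈ xs ⊕ ys →
  (∃ λ x → x ∈ xs × z ≡ inj₁ x) ⊎ (∃ λ y → y ∈ ys × z ≡ inj₂ y)
∈-⊕⁻ xs ys z∈ with ∈-++⁻ (map inj₁ xs) z∈
... | inj₁ z∈ˡ = inj₁ (∈-map⁻ inj₁ z∈ˡ)
... | inj₂ z∈ʳ = inj₂ (∈-map⁻ inj₂ z∈ʳ)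

⊕-unique : {xs : List A} {ys : List B} → Unique xs → Unique ys → Unique (xs ⊕ ys)
⊕-unique {xs = xs} {ys} uxs uys =
  Unique.++⁺ (Unique.map⁺ (λ { refl → refl }) uxs) (Unique.map⁺ (λ { refl → refl }) uys) disjoint
  where
  disjoint : ∀ {z} → z ∈ map inj₁ xs × z ∈ map inj₂ ys → ⊥
  disjoint (z∈ˡ , z∈ʳ) with ∈-map⁻ inj₁ z∈ˡ | ∈-map⁻ inj₂ z∈ʳ
  ... | _ , _ , refl | _ , _ , ()

injectiveOn-⊕⇒length≤ : (f : A → D) (g : B → D) {xs : List A} {ys : List B} {zs : List D} →
  Unique xs → Unique ys →
  (∀ {x} → x ∈ xs → f x ∈ zs) → (∀ {y} → y ∈ ys → g y ∈ zs) →
  InjectiveOn f xs → InjectiveOn g ys → (∀ {x y} → x ∈ xs → y ∈ ys → f x ≢ g y) →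
  length xs + length ys ≤ length zs
injectiveOn-⊕⇒length≤ f g {xs} {ys} {zs} uxs uys f-maps g-maps f-inj g-inj disjoint =
  subst (_≤ length zs) (length-⊕ xs ys)
    (injectiveOn⇒length≤ [ f , g ] (⊕-unique uxs uys) maps inj)
  where
  maps : ∀ {z} → z ∈ xs ⊕ ys → [ f , g ] z ∈ zs
  maps z∈ with ∈-⊕⁻ xs ys z∈
  ... | inj₁ (_ , x∈ , refl) = f-maps x∈
  ... | inj₂ (_ , y∈ , refl) = g-maps y∈
  inj : InjectiveOn [ f , g ] (xs ⊕ ys)
  inj z∈ z′∈ eq with ∈-⊕⁻ xs ys z∈ | ∈-⊕⁻ xs ys z′∈
  ... | inj₁ (_ , x∈ , refl) | inj₁ (_ , x′∈ , refl) = cong inj₁ (f-inj x∈ x′∈ eq)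
  ... | inj₁ (_ , x∈ , refl) | inj₂ (_ , y∈ , refl) = ⊥-elim (disjoint x∈ y∈ eq)
  ... | inj₂ (_ , y∈ , refl) | inj₁ (_ , x∈ , refl) = ⊥-elim (disjoint x∈ y∈ (sym eq))
  ... | inj₂ (_ , y∈ , refl) | inj₂ (_ , y′∈ , refl) = cong inj₂ (g-inj y∈ y′∈ eq)

module Positions {B : Set} (_≟_ : DecidableEquality B) (f : A → B) {xs : List A}
  (uniq : Unique xs) (inj : InjectiveOn f xs) {K : ℕ} (K≤ : K ≤ length xs) (default : Fin K) where

  entry : Fin K → A
  entry i = lookup xs (inject≤ i K≤)

  position : B → Fin K
  position b with any? (λ i → f (entry i) ≟ b)
  ... | yes (i , _) = i
  ... | no  _       = default

  position-entry : ∀ i → position (f (entry i)) ≡ i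
  position-entry i with any? (λ j → f (entry j) ≟ f (entry i))
  ... | yes (j , eq) =
    inject≤-injective K≤ K≤ j i (lookup-injective uniq _ _ (inj (∈-lookup _) (∈-lookup _) eq))
  ... | no  none     = ⊥-elim (none (i , refl))

  entry-∈ : ∀ i → entry i ∈ xs
  entry-∈ i = ∈-lookup _

length-allFin : ∀ n → length (allFin n) ≡ n
length-allFin n = length-tabulate {n = n} (λ i → i)

[1+n]C2≡n+nC2 : ∀ n → suc n C 2 ≡ n + n C 2
[1+n]C2≡n+nC2 n = trans (sym (nCk+nC[k+1]≡[n+1]C[k+1] n 1)) (cong (_+ n C 2) (nC1≡n n))

pairFromZero : Fin n → Fin (suc n) × Fin (suc n)
pairFromZero v = zero , suc v

suc₂ : Fin n × Fin n → Fin (suc n) × Fin (suc n)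
suc₂ (u , v) = suc u , suc v

increasingPairs : (n : ℕ) → List (Fin n × Fin n)
increasingPairs zero    = []
increasingPairs (suc n) = map pairFromZero (allFin n) ++ map suc₂ (increasingPairs n)

length-increasingPairs : ∀ n → length (increasingPairs n) ≡ n C 2
length-increasingPairs zero    = refl
length-increasingPairs (suc n) = begin
  length (map pairFromZero (allFin n) ++ map suc₂ (increasingPairs n))
    ≡⟨ length-++ (map pairFromZero (allFin n)) ⟩
  length (map pairFromZero (allFin n)) + length (map suc₂ (increasingPairs n))
    ≡⟨ cong₂ _+_ (trans (length-map _ (allFin n)) (length-allFin n))
                 (trans (length-map suc₂ (increasingPairs n)) (length-increasingPairs n)) ⟩
  n + n C 2
    ≡⟨ [1+n]C2≡n+nC2 n ⟨
  suc n C 2 ∎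
  where open ≡-Reasoning

increasingPairs-unique : ∀ n → Unique (increasingPairs n)
increasingPairs-unique zero    = []
increasingPairs-unique (suc n) = Unique.++⁺
  (Unique.map⁺ (λ eq → suc-injective (cong proj₂ eq)) (Unique.allFin⁺ n))
  (Unique.map⁺ (λ eq → cong₂ _,_ (suc-injective (cong proj₁ eq)) (suc-injective (cong proj₂ eq)))
               (increasingPairs-unique n))
  disjoint
  where
  disjoint : ∀ {p} → p ∈ map pairFromZero (allFin n) × p ∈ map suc₂ (increasingPairs n) → ⊥
  disjoint (p∈ˡ , p∈ʳ) with ∈-map⁻ _ p∈ˡ | ∈-map⁻ _ p∈ʳ
  ... | _ , _ , refl | _ , _ , ()

∈-increasingPairs⁻ : ∀ n {u v : Fin n} → (u , v) ∈ increasingPairs n → u < v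
∈-increasingPairs⁻ (suc n) p∈ with ∈-++⁻ (map pairFromZero (allFin n)) p∈
... | inj₁ p∈ˡ with ∈-map⁻ _ p∈ˡ
...   | _ , _ , refl = s≤s z≤n
∈-increasingPairs⁻ (suc n) p∈ | inj₂ p∈ʳ with ∈-map⁻ _ p∈ʳ
...   | _ , q∈ , refl = s≤s (∈-increasingPairs⁻ n q∈)

∈-increasingPairs⁺ : ∀ n {u v : Fin n} → u < v → (u , v) ∈ increasingPairs n
∈-increasingPairs⁺ (suc n) {zero}  {suc v} _         = ∈-++⁺ˡ (∈-map⁺ _ (∈-allFin v))
∈-increasingPairs⁺ (suc n) {suc u} {suc v} (s≤s u<v) =
  ∈-++⁺ʳ (map pairFromZero (allFin n)) (∈-map⁺ suc₂ (∈-increasingPairs⁺ n u<v))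

-- The unordered pair {u, v}, represented as an increasing pair.
sort₂ : Fin n → Fin n → Fin n × Fin n
sort₂ u v with u <? v
... | yes _ = u , v
... | no  _ = v , u

_≐_ : Fin n × Fin n → Fin n × Fin n → Set
(u , v) ≐ (x , y) = (u ≡ x × v ≡ y) ⊎ (u ≡ y × v ≡ x)

sort₂-≐ : ∀ (u v : Fin n) → sort₂ u v ≐ (u , v)
sort₂-≐ u v with u <? v
... | yes _ = inj₁ (refl , refl)
... | no  _ = inj₂ (refl , refl)

sort₂-comm : ∀ (u v : Fin n) → sort₂ u v ≡ sort₂ v u
sort₂-comm u v with u <? v | v <? u
... | yes _   | no _    = refl
... | no _    | yes _   = refl
... | yes u<v | yes v<u = ⊥-elim (<-asym u<v v<u)
... | no u≮v  | no v≮u with <-cmp u v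
...   | tri< u<v _ _ = ⊥-elim (u≮v u<v)
...   | tri≈ _ refl _ = refl
...   | tri> _ _ v<u = ⊥-elim (v≮u v<u)

sort₂-∈ : ∀ {u v : Fin n} → u ≢ v → sort₂ u v ∈ increasingPairs n
sort₂-∈ {n} {u} {v} u≢v with u <? v
... | yes u<v = ∈-increasingPairs⁺ n u<v
... | no  u≮v = ∈-increasingPairs⁺ n (≤∧≢⇒< (≮⇒≥ u≮v) (u≢v ∘ sym))

≐-flip : ∀ {p q r : Fin n × Fin n} → p ≐ q → p ≐ r → q ≐ r
≐-flip {p = _ , _} (inj₁ (refl , refl)) (inj₁ (refl , refl)) = inj₁ (refl , refl)
≐-flip {p = _ , _} (inj₁ (refl , refl)) (inj₂ (refl , refl)) = inj₂ (refl , refl)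
≐-flip {p = _ , _} (inj₂ (refl , refl)) (inj₁ (refl , refl)) = inj₂ (refl , refl)
≐-flip {p = _ , _} (inj₂ (refl , refl)) (inj₂ (refl , refl)) = inj₁ (refl , refl)

sort₂-injective : ∀ {u v x y : Fin n} → sort₂ u v ≡ sort₂ x y → (u , v) ≐ (x , y)
sort₂-injective {u = u} {v} {x} {y} eq = ≐-flip (subst (_≐ (u , v)) eq (sort₂-≐ u v)) (sort₂-≐ x y)

sort₂-increasing : ∀ {u v x y : Fin n} → u < v → (u , v) ≐ (x , y) → (u , v) ≡ sort₂ x y
sort₂-increasing {u = u} {v} u<v (inj₁ (refl , refl)) with u <? v
... | yes _   = refl
... | no  u≮v = ⊥-elim (u≮v u<v)
sort₂-increasing {u = u} {v} u<v (inj₂ (refl , refl)) with v <? u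
... | yes v<u = ⊥-elim (<-asym u<v v<u)
... | no  _   = refl

module Components {A : Set} (_≟_ : DecidableEquality A)
  (elems : List A) (elems-unique : Unique elems) (∈-elems : ∀ x → x ∈ elems) where

  -- Union-find by relabelling: joining x and y gives every element labelled L x the label L y.
  relabel : A → A → A → A
  relabel lx ly l with l ≟ lx
  ... | yes _ = ly
  ... | no  _ = l

  join : (A → A) → A × A → A → A
  join L (x , y) = relabel (L x) (L y) ∘ L

  joinAll : List (A × A) → (A → A) → A → A
  joinAll []       L = L
  joinAll (e ∷ es) L = joinAll es (join L e)

  joinAll-cong : ∀ es L {x y} → L x ≡ L y → joinAll es L x ≡ joinAll es L y
  joinAll-cong []             L eq = eq
  joinAll-cong ((x , y) ∷ es) L eq = joinAll-cong es (join L (x , y)) (cong (relabel _ _) eq)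

  relabel-old : ∀ lx ly → relabel lx ly lx ≡ ly
  relabel-old lx ly with lx ≟ lx
  ... | yes _   = refl
  ... | no  neq = ⊥-elim (neq refl)

  relabel-new : ∀ lx ly → relabel lx ly ly ≡ ly
  relabel-new lx ly with ly ≟ lx
  ... | yes _ = refl
  ... | no  _ = refl

  relabel-other : ∀ lx ly l → l ≢ lx → relabel lx ly l ≡ l
  relabel-other lx ly l l≢lx with l ≟ lx
  ... | yes eq = ⊥-elim (l≢lx eq)
  ... | no  _  = refl

  joinAll-joins : ∀ es L {x y} → (x , y) ∈ es → joinAll es L x ≡ joinAll es L y
  joinAll-joins ((x , y) ∷ es) L (here refl) =
    joinAll-cong es (join L (x , y)) (trans (relabel-old (L x) (L y)) (sym (relabel-new (L x) (L y))))
  joinAll-joins (e ∷ es) L (there e∈es) = joinAll-joins es (join L e) e∈es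

  image : (A → A) → List A
  image L = filter (λ y → Any.any? (λ x → L x ≟ y) elems) elems

  image-unique : ∀ L → Unique (image L)
  image-unique L = Unique.filter⁺ _ elems-unique

  ∈-image : ∀ L x → L x ∈ image L
  ∈-image L x = ∈-filter⁺ (λ y → Any.any? (λ x → L x ≟ y) elems) (∈-elems (L x))
    (Any.map (λ { refl → refl }) (∈-elems x))

  section : (A → A) → A → A
  section L y with Any.any? (λ x → L x ≟ y) elems
  ... | yes found = proj₁ (Any.satisfied found)
  ... | no  _     = y

  section-correct : ∀ L {y} → y ∈ image L → L (section L y) ≡ y
  section-correct L {y} y∈ with Any.any? (λ x → L x ≟ y) elems
  ... | yes found = proj₂ (Any.satisfied found)
  ... | no  none  =
    ⊥-elim (none (proj₂ (∈-filter⁻ (λ y → Any.any? (λ x → L x ≟ y) elems) {xs = elems} y∈)))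

  -- A join merges at most two labels, so the image shrinks by at most one.
  length-image-join : ∀ L e → length (image L) ≤ suc (length (image (join L e)))
  length-image-join L (x , y) = injectiveOn⇒length≤ id (image-unique L) maps (λ _ _ eq → eq)
    where
    maps : ∀ {l} → l ∈ image L → l ∈ L x ∷ image (join L (x , y))
    maps {l} l∈ with l ≟ L x
    ... | yes eq  = here eq
    ... | no  neq =
      there (subst (_∈ image (join L (x , y))) unchanged (∈-image (join L (x , y)) (section L l)))
      where
      unchanged : join L (x , y) (section L l) ≡ l
      unchanged =
        trans (cong (relabel (L x) (L y)) (section-correct L l∈)) (relabel-other (L x) (L y) l neq)

  length-image-joinAll : ∀ es L → length (image L) ≤ length es + length (image (joinAll es L))
  length-image-joinAll []       L = ≤-refl
  length-image-joinAll (e ∷ es) L =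
    ≤-trans (length-image-join L e) (s≤s (length-image-joinAll es (join L e)))

  length-elems≤ : ∀ es → length elems ≤ length es + length (image (joinAll es id))
  length-elems≤ es =
    ≤-trans (injectiveOn⇒length≤ id elems-unique (λ {x} _ → ∈-image id x) (λ _ _ eq → eq))
            (length-image-joinAll es id)

-- Abstracts the non-stars of G_n^t, each partnered with the star of its class.
record PartneredSet {n : ℕ} (G : Graph n) : Set₁ where
  field
    Member       : Fin n → Set
    member?      : Decidable Member
    partner      : Fin n → Fin n
    partner-∉    : ∀ {u} → Member u → ¬ Member (partner u)
    partner-≁    : ∀ {u} → Member u → ¬ Adj G u (partner u)

  members : List (Fin n)
  members = filter member? (allFin n)

  ∈-members⁻ : ∀ {u} → u ∈ members → Member u
  ∈-members⁻ u∈ = proj₂ (∈-filter⁻ member? {xs = allFin n} u∈)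

  partner-≢ : ∀ {u} → Member u → u ≢ partner u
  partner-≢ u∈ eq = partner-∉ u∈ (subst Member eq u∈)

module EdgeLists {n : ℕ} (G : Graph n) (adj? : ∀ u v → Dec (Adj G u v)) where

  edges : List (Fin n × Fin n)
  edges = filter (λ (u , v) → adj? u v) (increasingPairs n)

  nonEdges : List (Fin n × Fin n)
  nonEdges = filter (λ (u , v) → ¬? (adj? u v)) (increasingPairs n)

  length-edges+nonEdges : length edges + length nonEdges ≡ n C 2
  length-edges+nonEdges =
    trans (length-filter-∁ (λ (u , v) → adj? u v) (increasingPairs n)) (length-increasingPairs n)

  ∈-edges⁺ : ∀ {u v} → u < v → Adj G u v → (u , v) ∈ edges
  ∈-edges⁺ u<v uv = ∈-filter⁺ (λ (u , v) → adj? u v) (∈-increasingPairs⁺ n u<v) uv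

  -- u ↦ {u, partner u} is injective on S since partners lie outside S.
  length-members≤length-nonEdges : (S : PartneredSet G) → length (PartneredSet.members S) ≤ length nonEdges
  length-members≤length-nonEdges S =
    injectiveOn⇒length≤ (λ u → sort₂ u (partner u)) (Unique.filter⁺ member? (Unique.allFin⁺ n)) maps inj
    where
    open PartneredSet S
    nonAdj : ∀ {u} → Member u → ∀ {x y} → sort₂ u (partner u) ≡ (x , y) → ¬ Adj G x y
    nonAdj {u} u∈ eq xy with subst (_≐ (u , partner u)) eq (sort₂-≐ u (partner u))
    ... | inj₁ (refl , refl) = partner-≁ u∈ xy
    ... | inj₂ (refl , refl) = partner-≁ u∈ (symmetric G xy)
    maps : ∀ {u} → u ∈ members → sort₂ u (partner u) ∈ nonEdges
    maps u∈ = ∈-filter⁺ (λ (u , v) → ¬? (adj? u v))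
      (sort₂-∈ (partner-≢ (∈-members⁻ u∈))) (nonAdj (∈-members⁻ u∈) refl)
    inj : InjectiveOn (λ u → sort₂ u (partner u)) members
    inj u∈ v∈ eq with sort₂-injective eq
    ... | inj₁ (u≡v , _)       = u≡v
    ... | inj₂ (u≡pv , _)      = ⊥-elim (partner-∉ (∈-members⁻ v∈) (subst Member u≡pv (∈-members⁻ u∈)))

module UpperBound {n : ℕ} (G : Graph n) (adj? : ∀ u v → Dec (Adj G u v))
  {k : ℕ} (χ : EdgeColoring G (suc k)) (mc : IsMC G χ) (S : PartneredSet G) where

  open PartneredSet S
  open EdgeLists G adj?

  c : Fin n → Fin n → Fin (suc k)
  c = col χ

  -- Layer a holds a copy of the spanning subgraph formed by the edges of colour a.
  Vertex : Set
  Vertex = Fin (suc k) × Fin n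

  vertices : List Vertex
  vertices = cartesianProduct (allFin (suc k)) (allFin n)

  ∈-vertices : ∀ x → x ∈ vertices
  ∈-vertices (a , v) = ∈-cartesianProduct⁺ (∈-allFin a) (∈-allFin v)

  open Components (Product.≡-dec _≟_ _≟_) vertices
    (Unique.cartesianProduct⁺ (Unique.allFin⁺ (suc k)) (Unique.allFin⁺ n)) ∈-vertices

  layerEdge : Fin n × Fin n → Vertex × Vertex
  layerEdge (u , v) = (c u v , u) , (c u v , v)

  component : Vertex → Vertex
  component = joinAll (map layerEdge edges) id

  length-vertices≤ : length vertices ≤ length edges + length (image component)
  length-vertices≤ = subst (λ m → length vertices ≤ m + length (image component))
    (length-map layerEdge edges) (length-elems≤ (map layerEdge edges))

  component-edge : ∀ {a u v} → Adj G u v → c u v ≡ a → component (a , u) ≡ component (a , v)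
  component-edge {u = u} {v} uv refl with <-cmp u v
  ... | tri< u<v _ _ = joinAll-joins (map layerEdge edges) id (∈-map⁺ layerEdge (∈-edges⁺ u<v uv))
  ... | tri≈ _ u≡v _ = ⊥-elim (irrefl G (subst (Adj G u) (sym u≡v) uv))
  ... | tri> _ _ v<u rewrite col-sym χ u v =
    sym (joinAll-joins (map layerEdge edges) id (∈-map⁺ layerEdge (∈-edges⁺ v<u (symmetric G uv))))

  component-walk : ∀ {a u w vs} → MonoWalk G c a u w vs → component (a , u) ≡ component (a , w)
  component-walk (here _)         = refl
  component-walk (step uv c≡a W)  = trans (component-edge uv c≡a) (component-walk W)

  finalEdge : ∀ {a u v w vs} → Adj G u v → c u v ≡ a → MonoWalk G c a v w vs →
    ∃ λ y → Adj G y w × c y w ≡ a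
  finalEdge uv c≡a (here _)          = _ , uv , c≡a
  finalEdge _  _   (step vx c≡a W)   = finalEdge vx c≡a W

  lastEdge : ∀ {a u w vs} → MonoWalk G c a u w vs → u ≢ w → ∃ λ y → Adj G y w × c y w ≡ a
  lastEdge (here _)        u≢u = ⊥-elim (u≢u refl)
  lastEdge (step uv c≡a W) _   = finalEdge uv c≡a W

  -- The colour of a chosen monochromatic path from a member to its partner (junk value zero elsewhere).
  partnerColour : Fin n → Fin (suc k)
  partnerColour u with member? u
  ... | yes u∈ = proj₁ (mc u (partner u) (partner-≢ u∈))
  ... | no  _  = zero

  partnerWalk : ∀ {u} → Member u → ∃ λ vs → MonoWalk G c (partnerColour u) u (partner u) vs
  partnerWalk {u} u∈ with member? u
  ... | yes u∈′ = proj₁ (proj₂ (mc u (partner u) (partner-≢ u∈′)))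
                , proj₁ (proj₂ (proj₂ (mc u (partner u) (partner-≢ u∈′))))
  ... | no  u∉  = ⊥-elim (u∉ u∈)

  Routed : Fin (suc k) → Fin n → Set
  Routed a v = Member v × partnerColour v ≡ a

  partner-unrouted : ∀ {a v} → Member v → ¬ Routed a (partner v)
  partner-unrouted v∈ (pv∈ , _) = partner-∉ v∈ pv∈

  -- In layer a, a routed vertex lies in the component of its partner, which is not routed.
  representative : Fin (suc k) → Fin n → Fin n
  representative a v with member? v ×-dec (partnerColour v ≟ a)
  ... | yes _ = partner v
  ... | no  _ = v

  representative-unrouted : ∀ a v → ¬ Routed a (representative a v)
  representative-unrouted a v with member? v ×-dec (partnerColour v ≟ a)
  ... | yes (v∈ , _) = partner-unrouted v∈
  ... | no  unrouted = unrouted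

  component-representative : ∀ a v → component (a , representative a v) ≡ component (a , v)
  component-representative a v with member? v ×-dec (partnerColour v ≟ a)
  ... | yes (v∈ , refl) = sym (component-walk (proj₂ (partnerWalk v∈)))
  ... | no  _           = refl

  representative-≢-neighbour : ∀ {a x y} → Adj G x y → representative a y ≢ x
  representative-≢-neighbour {a} {x} {y} xy with member? y ×-dec (partnerColour y ≟ a)
  ... | yes (y∈ , _) = λ { refl → partner-≁ y∈ (symmetric G xy) }
  ... | no  _        = λ { refl → irrefl G xy }

  -- Every colour occurs, so each layer has two distinct unrouted vertices in one component.
  record Witness (a : Fin (suc k)) : Set where
    field
      w z        : Fin n
      w≢z        : w ≢ z
      w-unrouted : ¬ Routed a w
      z-unrouted : ¬ Routed a z
      component≡ : component (a , w) ≡ component (a , z)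

  witness : ∀ a → Witness a
  witness a with onto χ a
  ... | p , q , pq , c≡a with member? p ×-dec (partnerColour p ≟ a)
  ...   | no  unrouted = record
    { w = p ; z = representative a q
    ; w≢z = λ eq → representative-≢-neighbour pq (sym eq)
    ; w-unrouted = unrouted
    ; z-unrouted = representative-unrouted a q
    ; component≡ = trans (component-edge pq c≡a) (sym (component-representative a q)) }
  ...   | yes (p∈ , refl) with lastEdge (proj₂ (partnerWalk p∈)) (partner-≢ p∈)
  ...     | y , y~pp , cy≡a = record
    { w = partner p ; z = representative a y
    ; w≢z = λ eq → representative-≢-neighbour (symmetric G y~pp) (sym eq)
    ; w-unrouted = partner-unrouted p∈
    ; z-unrouted = representative-unrouted a y
    ; component≡ = sym (trans (component-representative a y) (component-edge y~pp cy≡a)) }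

  unrouted-≢ : ∀ {a v u} → ¬ Routed a v → Member u → (a , v) ≢ (partnerColour u , u)
  unrouted-≢ unrouted u∈ refl = unrouted (u∈ , refl)

  Free : Fin (suc k) → Fin n → Set
  Free a v = ¬ Routed a v × v ≢ Witness.w (witness a)

  retract′ : Fin (suc k) → Fin n → Fin n
  retract′ a v with representative a v ≟ Witness.w (witness a)
  ... | yes _ = Witness.z (witness a)
  ... | no  _ = representative a v

  -- Every component meets a free vertex of its layer.
  retract : Vertex → Vertex
  retract (a , v) = a , retract′ a v

  retract-free : ∀ a v → Free a (retract′ a v)
  retract-free a v with representative a v ≟ Witness.w (witness a)
  ... | yes _   = Witness.z-unrouted (witness a) , Witness.w≢z (witness a) ∘ sym
  ... | no  r≢w = representative-unrouted a v , r≢w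

  component-retract : ∀ x → component (retract x) ≡ component x
  component-retract (a , v) with representative a v ≟ Witness.w (witness a)
  ... | yes r≡w = begin
    component (a , Witness.z (witness a)) ≡⟨ Witness.component≡ (witness a) ⟨
    component (a , Witness.w (witness a)) ≡⟨ cong (λ u → component (a , u)) r≡w ⟨
    component (a , representative a v)    ≡⟨ component-representative a v ⟩
    component (a , v)                     ∎
    where open ≡-Reasoning
  ... | no  _   = component-representative a v

  unfree : Fin n ⊎ Fin (suc k) → Vertex
  unfree = [ (λ u → partnerColour u , u) , (λ a → a , Witness.w (witness a)) ]

  unfree-injective : InjectiveOn unfree (members ⊕ allFin (suc k))
  unfree-injective x∈ y∈ eq with ∈-⊕⁻ members (allFin (suc k)) x∈ | ∈-⊕⁻ members (allFin (suc k)) y∈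
  ... | inj₁ (u , _ , refl) | inj₁ (_ , _ , refl) = cong inj₁ (cong proj₂ eq)
  ... | inj₂ (a , _ , refl) | inj₂ (_ , _ , refl) = cong inj₂ (cong proj₁ eq)
  ... | inj₁ (u , u∈ , refl) | inj₂ (a , _ , refl) =
    ⊥-elim (unrouted-≢ (Witness.w-unrouted (witness a)) (∈-members⁻ u∈) (sym eq))
  ... | inj₂ (a , _ , refl) | inj₁ (u , u∈ , refl) =
    ⊥-elim (unrouted-≢ (Witness.w-unrouted (witness a)) (∈-members⁻ u∈) eq)

  retract∘section-injective : InjectiveOn (retract ∘ section component) (image component)
  retract∘section-injective {x} {y} x∈ y∈ eq = begin
    x                                         ≡⟨ section-correct component x∈ ⟨
    component (section component x)           ≡⟨ component-retract (section component x) ⟨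
    component (retract (section component x)) ≡⟨ cong component eq ⟩
    component (retract (section component y)) ≡⟨ component-retract (section component y) ⟩
    component (section component y)           ≡⟨ section-correct component y∈ ⟩
    y                                         ∎
    where open ≡-Reasoning

  free-≢-unfree : ∀ {a v y} → Free a v → y ∈ members ⊕ allFin (suc k) → (a , v) ≢ unfree y
  free-≢-unfree (unrouted , _) y∈ eq with ∈-⊕⁻ members (allFin (suc k)) y∈
  ... | inj₁ (u , u∈ , refl) = unrouted-≢ unrouted (∈-members⁻ u∈) eq
  free-≢-unfree (_ , v≢w) y∈ refl | inj₂ (a , _ , refl) = v≢w refl

  -- Components inject into free vertices, and these avoid the |S| + k unfree vertices.
  members+colours≤edges : length members + suc k ≤ length edges
  members+colours≤edges = +-cancelˡ-≤ (length (image component)) _ _ (begin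
    length (image component) + (length members + suc k) ≤⟨ counted ⟩
    length vertices                                     ≤⟨ length-vertices≤ ⟩
    length edges + length (image component)            ≡⟨ +-comm (length edges) _ ⟩
    length (image component) + length edges            ∎)
    where
    open ≤-Reasoning
    layers : length (members ⊕ allFin (suc k)) ≡ length members + suc k
    layers = trans (length-⊕ members (allFin (suc k))) (cong (length members +_) (length-allFin (suc k)))
    counted : length (image component) + (length members + suc k) ≤ length vertices
    counted = subst (λ m → length (image component) + m ≤ length vertices) layers
      (injectiveOn-⊕⇒length≤ (retract ∘ section component) unfree
        (image-unique component)
        (⊕-unique (Unique.filter⁺ member? (Unique.allFin⁺ n)) (Unique.allFin⁺ (suc k)))
        (λ _ → ∈-vertices _) (λ _ → ∈-vertices _)
        retract∘section-injective
        unfree-injective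
        (λ {x} _ y∈ → free-≢-unfree (retract-free _ (proj₂ (section component x))) y∈))

module GntStructure {n t : ℕ} (cls : Fin n → Fin t) (star : Fin t → Fin n)
  (cls∘star : ∀ j → cls (star j) ≡ j) where

  G : Graph n
  G = Gnt cls star

  adj? : ∀ u v → Dec (Adj G u v)
  adj? u v = ¬? (u ≟ v) ×-dec ¬? ((cls u ≟ cls v) ×-dec ((u ≟ star (cls u)) ⊎-dec (v ≟ star (cls v))))

  open EdgeLists G adj? public

  star-injective : ∀ {i j} → star i ≡ star j → i ≡ j
  star-injective {i} {j} eq = trans (sym (cls∘star i)) (trans (cong cls eq) (cls∘star j))

  IsStar : Fin n → Set
  IsStar v = v ≡ star (cls v)

  isStar? : ∀ v → Dec (IsStar v)
  isStar? v = v ≟ star (cls v)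

  star-isStar : ∀ j → IsStar (star j)
  star-isStar j = cong star (sym (cls∘star j))

  star-≁ : ∀ u → ¬ Adj G u (star (cls u))
  star-≁ u (_ , notDeleted) = notDeleted (sym (cls∘star (cls u)) , inj₂ (star-isStar (cls u)))

  distinctClasses⇒adj : ∀ {u v} → cls u ≢ cls v → Adj G u v
  distinctClasses⇒adj differ = (λ u≡v → differ (cong cls u≡v)) , (λ deleted → differ (proj₁ deleted))

  ≁⇒deleted : ∀ {u v} → u ≢ v → ¬ Adj G u v → cls u ≡ cls v × (IsStar u ⊎ IsStar v)
  ≁⇒deleted {u} {v} u≢v u≁v with cls u ≟ cls v | isStar? u | isStar? v
  ... | yes same  | yes u* | _      = same , inj₁ u*
  ... | yes same  | no _   | yes v* = same , inj₂ v*
  ... | yes _     | no ¬u* | no ¬v* =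
    ⊥-elim (u≁v (u≢v , λ { (_ , inj₁ u*) → ¬u* u* ; (_ , inj₂ v*) → ¬v* v* }))
  ... | no differ | _      | _      = ⊥-elim (u≁v (distinctClasses⇒adj differ))

  nonStars : PartneredSet G
  nonStars = record
    { Member    = λ v → ¬ IsStar v
    ; member?   = λ v → ¬? (isStar? v)
    ; partner   = λ v → star (cls v)
    ; partner-∉ = λ _ notStar → notStar (star-isStar (cls _))
    ; partner-≁ = λ {u} _ → star-≁ u
    }

  open PartneredSet nonStars using (members)

  -- Each vertex is a non-star or the star of its class.
  n≤nonStars+t : n ≤ length members + t
  n≤nonStars+t = subst₂ _≤_ (length-allFin n)
    (trans (length-⊕ members (allFin t)) (cong (length members +_) (length-allFin t)))
    (injectiveOn⇒length≤ classify (Unique.allFin⁺ n) maps inj)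
    where
    classify : Fin n → Fin n ⊎ Fin t
    classify v with isStar? v
    ... | yes _ = inj₂ (cls v)
    ... | no  _ = inj₁ v
    maps : ∀ {v} → v ∈ allFin n → classify v ∈ members ⊕ allFin t
    maps {v} _ with isStar? v
    ... | yes _       = ∈-⊕⁺ʳ members (∈-allFin (cls v))
    ... | no  notStar = ∈-⊕⁺ˡ (allFin t) (∈-filter⁺ (λ v → ¬? (isStar? v)) (∈-allFin v) notStar)
    inj : InjectiveOn classify (allFin n)
    inj {u} {v} _ _ with isStar? u | isStar? v
    ... | yes u* | yes v* = λ eq → trans u* (trans (cong star (inj₂-injective eq)) (sym v*))
    ... | yes _  | no _   = λ ()
    ... | no _   | yes _  = λ ()
    ... | no _   | no _   = inj₁-injective

  nonStarEnd : Fin n × Fin n → Fin n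
  nonStarEnd (u , v) with isStar? u
  ... | yes _ = v
  ... | no  _ = u

  nonEdge-shape : ∀ {u v} → (u , v) ∈ nonEdges →
    ¬ IsStar (nonStarEnd (u , v)) × (u , v) ≡ sort₂ (nonStarEnd (u , v)) (star (cls (nonStarEnd (u , v))))
  nonEdge-shape {u} {v} uv∈ with ∈-filter⁻ (λ (u , v) → ¬? (adj? u v)) {xs = increasingPairs n} uv∈
  ... | uv∈′ , u≁v with ∈-increasingPairs⁻ n uv∈′
  ...   | u<v with ≁⇒deleted (<⇒≢ u<v) u≁v | isStar? u
  ...     | same , _       | yes u* = ¬v* , sort₂-increasing u<v (inj₂ (trans u* (cong star same) , refl))
    where
    ¬v* : ¬ IsStar v
    ¬v* v* = <⇒≢ u<v (trans u* (trans (cong star same) (sym v*)))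
  ...     | _    , inj₁ u* | no ¬u* = ⊥-elim (¬u* u*)
  ...     | same , inj₂ v* | no ¬u* =
    ¬u* , sort₂-increasing u<v (inj₁ (refl , trans v* (cong star (sym same))))

  nonEdges+t≤n : length nonEdges + t ≤ n
  nonEdges+t≤n = subst (length nonEdges + t ≤_) (length-allFin n)
    (subst (λ m → length nonEdges + m ≤ length (allFin n)) (length-allFin t)
      (injectiveOn-⊕⇒length≤ nonStarEnd star
        (Unique.filter⁺ _ (increasingPairs-unique n)) (Unique.allFin⁺ t)
        (λ _ → ∈-allFin _) (λ _ → ∈-allFin _)
        (λ p∈ q∈ eq → trans (proj₂ (nonEdge-shape p∈))
          (trans (cong (λ x → sort₂ x (star (cls x))) eq) (sym (proj₂ (nonEdge-shape q∈)))))
        (λ _ _ eq → star-injective eq)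
        (λ {_} {j} p∈ _ eq → proj₁ (nonEdge-shape p∈) (subst IsStar (sym eq) (star-isStar j)))))

  module HubColouring (next : Fin t → Fin t) (next-≢ : ∀ j → next j ≢ j)
    (next²-≢ : ∀ j → next (next j) ≢ j) where

    hub : Fin t → Fin n
    hub j = star (next j)

    cls-hub : ∀ j → cls (hub j) ≡ next j
    cls-hub j = cls∘star (next j)

    hub-adj : ∀ {v} → Adj G (hub (cls v)) v
    hub-adj {v} = distinctClasses⇒adj (next-≢ (cls v) ∘ trans (sym (cls-hub (cls v))))

    not-mutual-hubs : ∀ {u v} → u ≡ hub (cls v) → v ≡ hub (cls u) → ⊥
    not-mutual-hubs {u} {v} refl v≡ = next²-≢ (cls v) (sym (begin
      cls v                   ≡⟨ cong cls v≡ ⟩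
      cls (hub (cls u))       ≡⟨ cls-hub (cls u) ⟩
      next (cls u)            ≡⟨ cong next (cls-hub (cls v)) ⟩
      next (next (cls v))     ∎))
      where open ≡-Reasoning

    Key : Set
    Key = (Fin n × Fin n) ⊎ Fin t

    _≟ᴷ_ : (κ κ′ : Key) → Dec (κ ≡ κ′)
    _≟ᴷ_ = Sum.≡-dec (Product.≡-dec _≟_ _≟_) _≟_

    key : Fin n → Fin n → Key
    key u v with u ≟ hub (cls v) | v ≟ hub (cls u)
    ... | yes _ | _     = inj₂ (cls v)
    ... | no  _ | yes _ = inj₂ (cls u)
    ... | no  _ | no  _ = inj₁ (sort₂ u v)

    key-hubˡ : ∀ {u v} → u ≡ hub (cls v) → key u v ≡ inj₂ (cls v)
    key-hubˡ {u} {v} u≡ with u ≟ hub (cls v)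
    ... | yes _ = refl
    ... | no  u≢ = ⊥-elim (u≢ u≡)

    key-hubʳ : ∀ {u v} → v ≡ hub (cls u) → key u v ≡ inj₂ (cls u)
    key-hubʳ {u} {v} v≡ with u ≟ hub (cls v) | v ≟ hub (cls u)
    ... | yes u≡ | _     = ⊥-elim (not-mutual-hubs u≡ v≡)
    ... | no  _  | yes _ = refl
    ... | no  _  | no v≢ = ⊥-elim (v≢ v≡)

    key-ordinary : ∀ {u v} → u ≢ hub (cls v) → v ≢ hub (cls u) → key u v ≡ inj₁ (sort₂ u v)
    key-ordinary {u} {v} u≢ v≢ with u ≟ hub (cls v) | v ≟ hub (cls u)
    ... | yes u≡ | _      = ⊥-elim (u≢ u≡)
    ... | no  _  | yes v≡ = ⊥-elim (v≢ v≡)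
    ... | no  _  | no  _  = refl

    key-comm : ∀ u v → key u v ≡ key v u
    key-comm u v = cases (u ≟ hub (cls v)) (v ≟ hub (cls u))
      where
      cases : Dec (u ≡ hub (cls v)) → Dec (v ≡ hub (cls u)) → key u v ≡ key v u
      cases (yes u≡) _        = trans (key-hubˡ u≡) (sym (key-hubʳ u≡))
      cases (no  _)  (yes v≡) = trans (key-hubʳ v≡) (sym (key-hubˡ v≡))
      cases (no  u≢) (no v≢)  =
        trans (key-ordinary u≢ v≢) (trans (cong inj₁ (sort₂-comm u v)) (sym (key-ordinary v≢ u≢)))

    -- Non-adjacent vertices share a class, and the two edges through its hub share a key.
    keyColouring-MC : ∀ {K} (φ : Key → Fin K) u v → u ≢ v → MonoPath G (λ x y → φ (key x y)) u v
    keyColouring-MC φ u v u≢v with adj? u v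
    ... | yes uv = φ (key u v) , u ∷ v ∷ [] , step uv refl (here v) , (u≢v ∷ []) ∷ [] ∷ []
    ... | no  u≁v with ≁⇒deleted u≢v u≁v
    ...   | same , _ =
      φ (key u h) , u ∷ h ∷ v ∷ []
      , step (symmetric G hub-adj) refl (step h-v (cong φ (sym keys≡)) (here v))
      , (u≢h ∷ u≢v ∷ []) ∷ (h≢v ∷ []) ∷ [] ∷ []
      where
      h = hub (cls u)
      h-v : Adj G h v
      h-v = subst (λ j → Adj G (hub j) v) (sym same) hub-adj
      u≢h : u ≢ h
      u≢h u≡h = irrefl G (subst (Adj G h) u≡h hub-adj)
      h≢v : h ≢ v
      h≢v h≡v = irrefl G (subst (Adj G h) (sym h≡v) h-v)
      keys≡ : key u h ≡ key h v
      keys≡ = begin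
        key u h        ≡⟨ key-comm u h ⟩
        key h u        ≡⟨ key-hubˡ refl ⟩
        inj₂ (cls u)   ≡⟨ cong inj₂ same ⟩
        inj₂ (cls v)   ≡⟨ key-hubˡ (cong hub same) ⟨
        key h v        ∎
        where open ≡-Reasoning

    pairKey : Fin n × Fin n → Key
    pairKey (u , v) = key u v

    Ordinary : Fin n × Fin n → Set
    Ordinary (u , v) = u ≢ hub (cls v) × v ≢ hub (cls u)

    ordinary? : ∀ p → Dec (Ordinary p)
    ordinary? (u , v) = ¬? (u ≟ hub (cls v)) ×-dec ¬? (v ≟ hub (cls u))

    ordinaryEdges : List (Fin n × Fin n)
    ordinaryEdges = filter ordinary? edges

    specialEdges : List (Fin n × Fin n)
    specialEdges = filter (λ p → ¬? (ordinary? p)) edges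

    hubEdge : Fin t → Fin n × Fin n
    hubEdge j = hub j , star j

    colourEdges : List (Fin n × Fin n)
    colourEdges = ordinaryEdges ++ map hubEdge (allFin t)

    ∈-ordinaryEdges⁻ : ∀ {p} → p ∈ ordinaryEdges → p ∈ edges × pairKey p ≡ inj₁ p
    ∈-ordinaryEdges⁻ {u , v} p∈ with ∈-filter⁻ ordinary? {xs = edges} p∈
    ... | p∈edges , (u≢ , v≢) with ∈-filter⁻ (λ (u , v) → adj? u v) {xs = increasingPairs n} p∈edges
    ...   | p∈pairs , _ = p∈edges , trans (key-ordinary u≢ v≢)
              (cong inj₁ (sym (sort₂-increasing (∈-increasingPairs⁻ n p∈pairs) (inj₁ (refl , refl)))))

    data ColourEdge : Fin n × Fin n → Set where
      ordinary : ∀ {p} → p ∈ edges → pairKey p ≡ inj₁ p → ColourEdge p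
      hubbed   : ∀ j → ColourEdge (hubEdge j)

    colourEdge : ∀ {p} → p ∈ colourEdges → ColourEdge p
    colourEdge p∈ with ∈-++⁻ ordinaryEdges p∈
    ... | inj₁ p∈ord = let p∈edges , key≡ = ∈-ordinaryEdges⁻ p∈ord in ordinary p∈edges key≡
    ... | inj₂ p∈hub with ∈-map⁻ hubEdge p∈hub
    ...   | j , _ , refl = hubbed j

    pairKey-hubEdge : ∀ j → pairKey (hubEdge j) ≡ inj₂ j
    pairKey-hubEdge j = trans (key-hubˡ (cong hub (sym (cls∘star j)))) (cong inj₂ (cls∘star j))

    colourEdge-adj : ∀ {p} → ColourEdge p → Adj G (proj₁ p) (proj₂ p)
    colourEdge-adj (ordinary p∈ _) = proj₂ (∈-filter⁻ (λ (u , v) → adj? u v) {xs = increasingPairs n} p∈)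
    colourEdge-adj (hubbed j) = subst (λ i → Adj G (hub i) (star j)) (cls∘star j) hub-adj

    pairKey-injective : InjectiveOn pairKey colourEdges
    pairKey-injective p∈ q∈ eq with colourEdge p∈ | colourEdge q∈
    ... | ordinary _ k₁ | ordinary _ k₂ = inj₁-injective (trans (sym k₁) (trans eq k₂))
    ... | ordinary _ k₁ | hubbed j      = case trans (sym k₁) (trans eq (pairKey-hubEdge j)) of λ ()
    ... | hubbed i      | ordinary _ k₂ = case trans (sym (pairKey-hubEdge i)) (trans eq k₂) of λ ()
    ... | hubbed i      | hubbed j      =
      cong hubEdge (inj₂-injective (trans (sym (pairKey-hubEdge i)) (trans eq (pairKey-hubEdge j))))

    colourEdges-unique : Unique colourEdges
    colourEdges-unique = Unique.++⁺
      (Unique.filter⁺ ordinary? (Unique.filter⁺ _ (increasingPairs-unique n)))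
      (Unique.map⁺ (star-injective ∘ cong proj₂) (Unique.allFin⁺ t))
      disjoint
      where
      disjoint : ∀ {p} → p ∈ ordinaryEdges × p ∈ map hubEdge (allFin t) → ⊥
      disjoint (p∈ord , p∈hub) with ∈-map⁻ hubEdge p∈hub
      ... | j , _ , refl = case trans (sym (proj₂ (∈-ordinaryEdges⁻ p∈ord))) (pairKey-hubEdge j) of λ ()

    nonHubEnd : Fin n × Fin n → Fin n
    nonHubEnd (u , v) with u ≟ hub (cls v)
    ... | yes _ = v
    ... | no  _ = u

    specialEdge-shape : ∀ {p} → p ∈ specialEdges → p ≡ sort₂ (hub (cls (nonHubEnd p))) (nonHubEnd p)
    specialEdge-shape {u , v} p∈ with ∈-filter⁻ (λ p → ¬? (ordinary? p)) {xs = edges} p∈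
    ... | p∈edges , special with ∈-filter⁻ (λ (u , v) → adj? u v) {xs = increasingPairs n} p∈edges
    ...   | p∈pairs , _ with ∈-increasingPairs⁻ n p∈pairs | u ≟ hub (cls v) | v ≟ hub (cls u)
    ...     | u<v | yes u≡ | _      = sort₂-increasing u<v (inj₁ (u≡ , refl))
    ...     | u<v | no  _  | yes v≡ = sort₂-increasing u<v (inj₂ (refl , v≡))
    ...     | _   | no  u≢ | no  v≢ = ⊥-elim (special (u≢ , v≢))

    specialEdges≤n : length specialEdges ≤ n
    specialEdges≤n = subst (length specialEdges ≤_) (length-allFin n)
      (injectiveOn⇒length≤ nonHubEnd (Unique.filter⁺ _ (Unique.filter⁺ _ (increasingPairs-unique n)))
        (λ _ → ∈-allFin _)
        (λ p∈ q∈ eq → trans (specialEdge-shape p∈)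
                            (trans (cong (λ x → sort₂ (hub (cls x)) x) eq) (sym (specialEdge-shape q∈)))))

    length-ordinary+special : length ordinaryEdges + length specialEdges ≡ length edges
    length-ordinary+special = length-filter-∁ ordinary? edges

    length-colourEdges : length colourEdges ≡ length ordinaryEdges + t
    length-colourEdges = trans (length-++ ordinaryEdges)
      (cong (length ordinaryEdges +_) (trans (length-map hubEdge (allFin t)) (length-allFin t)))

    module Colouring {K : ℕ} (K≤ : K ≤ length colourEdges) (default : Fin K) where
      open Positions _≟ᴷ_ pairKey colourEdges-unique pairKey-injective K≤ default

      colouring : EdgeColoring G K
      colouring = record
        { col     = λ u v → position (key u v)
        ; col-sym = λ u v → cong position (key-comm u v)
        ; onto    = λ i → proj₁ (entry i) , proj₂ (entry i)
                        , colourEdge-adj (colourEdge (entry-∈ i)) , position-entry i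
        }

      colouring-MC : IsMC G colouring
      colouring-MC = keyColouring-MC position

n+n≤nC2+5 : ∀ n → n + n ≤ n C 2 + 5
n+n≤nC2+5 0 = z≤n
n+n≤nC2+5 1 = s≤s (s≤s z≤n)
n+n≤nC2+5 2 = s≤s (s≤s (s≤s (s≤s z≤n)))
n+n≤nC2+5 (suc (suc (suc m))) = begin
  suc m′ + suc m′    ≡⟨ cong suc (+-suc m′ m′) ⟩
  2 + (m′ + m′)      ≤⟨ +-monoʳ-≤ 2 (n+n≤nC2+5 (suc (suc m))) ⟩
  2 + (m′ C 2 + 5)   ≤⟨ +-monoˡ-≤ (m′ C 2 + 5) (s≤s (s≤s (z≤n {m}))) ⟩
  m′ + (m′ C 2 + 5)  ≡⟨ +-assoc m′ (m′ C 2) 5 ⟨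
  (m′ + m′ C 2) + 5  ≡⟨ cong (_+ 5) ([1+n]C2≡n+nC2 m′) ⟨
  suc m′ C 2 + 5     ∎
  where
  open ≤-Reasoning
  m′ : ℕ
  m′ = suc (suc m)

colours-positive : ∀ n t → 3 ≤ t → 1 ≤ (n C 2 + 2 * t) ∸ (2 * n)
colours-positive n t 3≤t = m+n≤o⇒m≤o∸n 1 (begin
  1 + 2 * n          ≡⟨ cong (λ m → 1 + (n + m)) (+-identityʳ n) ⟩
  1 + (n + n)        ≤⟨ +-monoʳ-≤ 1 (n+n≤nC2+5 n) ⟩
  1 + (n C 2 + 5)    ≡⟨ +-suc (n C 2) 5 ⟨
  n C 2 + 2 * 3      ≤⟨ +-monoʳ-≤ (n C 2) (*-monoʳ-≤ 2 3≤t) ⟩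
  n C 2 + 2 * t      ∎)
  where open ≤-Reasoning

colours≤ : ∀ {k s e e′ c n t} → s + k ≤ e → e + e′ ≡ c → s ≤ e′ → n ≤ s + t →
  k ≤ (c + 2 * t) ∸ (2 * n)
colours≤ {k} {s} {e} {e′} {c} {n} {t} s+k≤e e+e′≡c s≤e′ n≤s+t = m+n≤o⇒m≤o∸n k (begin
  k + 2 * n               ≤⟨ +-monoʳ-≤ k (*-monoʳ-≤ 2 n≤s+t) ⟩
  k + 2 * (s + t)         ≡⟨ regroup k s t ⟩
  (s + k) + (s + 2 * t)   ≤⟨ +-mono-≤ s+k≤e (+-monoˡ-≤ (2 * t) s≤e′) ⟩
  e + (e′ + 2 * t)        ≡⟨ +-assoc e e′ (2 * t) ⟨
  (e + e′) + 2 * t        ≡⟨ cong (_+ 2 * t) e+e′≡c ⟩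
  c + 2 * t               ∎)
  where
  open ≤-Reasoning
  regroup : ∀ k s t → k + 2 * (s + t) ≡ (s + k) + (s + 2 * t)
  regroup = solve-∀

colours≥ : ∀ {o sp e e′ c n t} → o + sp ≡ e → e + e′ ≡ c → e′ + t ≤ n → sp ≤ n →
  (c + 2 * t) ∸ (2 * n) ≤ o + t
colours≥ {o} {sp} {e} {e′} {c} {n} {t} o+sp≡e e+e′≡c e′+t≤n sp≤n = m≤n+o⇒m∸n≤o (c + 2 * t) (2 * n) (begin
  c + 2 * t                   ≡⟨ cong (λ x → x + 2 * t) e+e′≡c ⟨
  (e + e′) + 2 * t            ≡⟨ cong (λ x → (x + e′) + 2 * t) o+sp≡e ⟨
  ((o + sp) + e′) + 2 * t     ≡⟨ regroup o sp e′ t ⟩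
  (o + t) + (sp + (e′ + t))   ≤⟨ +-monoʳ-≤ (o + t) (+-mono-≤ sp≤n e′+t≤n) ⟩
  (o + t) + (n + n)           ≡⟨ +-comm (o + t) (n + n) ⟩
  (n + n) + (o + t)           ≡⟨ cong (λ m → (n + m) + (o + t)) (+-identityʳ n) ⟨
  2 * n + (o + t)             ∎)
  where
  open ≤-Reasoning
  regroup : ∀ o sp e′ t → ((o + sp) + e′) + 2 * t ≡ (o + t) + (sp + (e′ + t))
  regroup = solve-∀

rotation : ∀ {t} → 3 ≤ t →
  Σ (Fin t → Fin t) λ next → (∀ j → next j ≢ j) × (∀ j → next (next j) ≢ j)
rotation (s≤s (s≤s (s≤s _))) = next , next-≢ , next²-≢
  where
  next : Fin (suc (suc (suc _))) → Fin (suc (suc (suc _)))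
  next zero                = suc zero
  next (suc zero)          = suc (suc zero)
  next (suc (suc zero))    = zero
  next (suc (suc (suc _))) = zero
  next-≢ : ∀ j → next j ≢ j
  next-≢ zero                ()
  next-≢ (suc zero)          ()
  next-≢ (suc (suc zero))    ()
  next-≢ (suc (suc (suc _))) ()
  next²-≢ : ∀ j → next (next j) ≢ j
  next²-≢ zero                ()
  next²-≢ (suc zero)          ()
  next²-≢ (suc (suc zero))    ()
  next²-≢ (suc (suc (suc _))) ()

lemma4 : (n t : ℕ) → 3 ≤ t → t ≤ n →
    (cls : Fin n → Fin t) → Balanced cls →
    (star : Fin t → Fin n) → (∀ j → cls (star j) ≡ j) →
    MCNumber (Gnt cls star) ((n C 2 + 2 * t) ∸ (2 * n))
lemma4 n t 3≤t _ cls _ star cls∘star = lower , upper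
  where
  open GntStructure cls star cls∘star
  upper : ∀ k (χ : EdgeColoring G k) → IsMC G χ → k ≤ (n C 2 + 2 * t) ∸ (2 * n)
  upper zero    _ _  = z≤n
  upper (suc k) χ mc = colours≤ (UpperBound.members+colours≤edges G adj? χ mc nonStars)
    length-edges+nonEdges (length-members≤length-nonEdges nonStars) n≤nonStars+t
  lower : Σ (EdgeColoring G ((n C 2 + 2 * t) ∸ (2 * n))) (IsMC G)
  lower with rotation 3≤t
  ... | next , next-≢ , next²-≢ = colouring , colouring-MC
    where
    open HubColouring next next-≢ next²-≢
    enough : (n C 2 + 2 * t) ∸ (2 * n) ≤ length colourEdges
    enough = subst (_ ≤_) (sym length-colourEdges)
      (colours≥ length-ordinary+special length-edges+nonEdges nonEdges+t≤n specialEdges≤n)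
    open Colouring enough (fromℕ< (colours-positive n t 3≤t))
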